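{- Let $(G,k,F,T,w)$ be an almost leafless ELSS instance such that $G$ is connected and $N_G(F) \neq \emptyset$. Fix some $v \in N_G(T)$ and let $P = (v = v_1, v_2, \ldots, v_\ell)$ be the unique maximal path disjoint from $T$ satisfying $\deg_G(v_i) = 2$ for each $1 \le i < \ell$ and ($v_\ell \in N_G(T)$ or $\deg_G(v_\ell) > 2$); concretely, $P$ is obtained by starting from $(v_1)$ and, while the last vertex $v_j$ has $\deg_G(v_j) = 2$ and $N_G(v_j) \setminus (V(P) \cup T)$ consists of a single vertex, appending that vertex. Then for any maximum-weight $k$-secluded supertree $H$ of $F$ in $G$, exactly one of the following holds: (1) $v_\ell \in N_G(H)$ (so $v_\ell \notin F$); (2) $|N_G(H) \cap (V(P) \setminus (F \cup \{v_\ell\}))| = 1$ and $v_\ell \in V(H)$; (3) $V(P) \subseteq V(H)$.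
   Context: Graphs are simple and undirected; $N_G(S)$ is the open neighborhood of $S\subseteq V(G)$, and for an induced subgraph $H$, $N_G(H) := N_G(V(H))$, $w(H) := \sum_{x \in V(H)} w(x)$. An ELSS instance is a tuple $(G,k,F,T,w)$ with $G$ a graph, $k$ a non-negative integer, non-empty vertex sets $T \subseteq F \subseteq V(G)$ with $G[T]$ connected, and $w \colon V(G) \to \mathbb{N}^+$. The instance is almost leafless if every vertex $u$ of degree $1$ in $G$ satisfies $F = \{u\}$. A $k$-secluded supertree of $F$ in $G$ is an induced subgraph $H$ of $G$ that is a tree with $F \subseteq V(H)$ and $|N_G(H)| \le k$; a maximum-weight one maximizes $w(H)$ among all $k$-secluded supertrees of $F$ in $G$. -}

module Defs where

open import Data.Nat using (ℕ; zero; suc; _+_; _≤_; _<_)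
open import Data.Bool using (Bool; true; false; not; _∧_; _∨_; if_then_else_)
open import Data.Fin using (Fin; _≟_)
open import Data.List using (List; []; _∷_; map; allFin; length)
open import Data.Nat.ListAction using (sum)
open import Data.Bool.ListAction using (any)
open import Data.List.Relation.Unary.Linked using (Linked)
open import Data.List.Relation.Unary.Unique.Propositional using (Unique)
open import Data.List.Relation.Unary.All using (All)
open import Data.Product using (Σ; ∃; _×_)
open import Data.Sum using (_⊎_)
open import Data.Empty using (⊥)
open import Relation.Nullary using (¬_; Dec)
open import Relation.Nullary.Decidable using (⌊_⌋)
open import Relation.Binary.PropositionalEquality using (_≡_; _≢_)

record Graph (n : ℕ) : Set where
  field
    adj     : Fin n → Fin n → Bool
    adj-sym : ∀ x y → adj x y ≡ adj y x
    adj-irr : ∀ x → adj x x ≡ false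
open Graph public

VSet : ℕ → Set
VSet n = Fin n → Bool

_∈ᵥ_ : ∀ {n} → Fin n → VSet n → Set
x ∈ᵥ S = S x ≡ true

_⊆ᵥ_ : ∀ {n} → VSet n → VSet n → Set
S ⊆ᵥ S' = ∀ x → x ∈ᵥ S → x ∈ᵥ S'

Adj : ∀ {n} → Graph n → Fin n → Fin n → Set
Adj G x y = adj G x y ≡ true

card : ∀ {n} → VSet n → ℕ
card {n} S = sum (map (λ x → if S x then 1 else 0) (allFin n))

nbr : ∀ {n} → Graph n → Fin n → VSet n
nbr G x = adj G x

deg : ∀ {n} → Graph n → Fin n → ℕ
deg G x = card (nbr G x)

N : ∀ {n} → Graph n → VSet n → VSet n
N {n} G S y = not (S y) ∧ any (λ x → S x ∧ adj G x y) (allFin n)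

listSet : ∀ {n} → List (Fin n) → VSet n
listSet vs y = any (λ z → ⌊ z ≟ y ⌋) vs

weight : ∀ {n} → (Fin n → ℕ) → VSet n → ℕ
weight {n} w S = sum (map (λ x → if S x then w x else 0) (allFin n))

data Walk {n} (G : Graph n) (S : VSet n) : Fin n → Fin n → Set where
  here : ∀ {x} → x ∈ᵥ S → Walk G S x x
  step : ∀ {x y z} → x ∈ᵥ S → Adj G x y → Walk G S y z → Walk G S x z

Connected : ∀ {n} → Graph n → VSet n → Set
Connected G S = ∀ x y → x ∈ᵥ S → y ∈ᵥ S → Walk G S x y

CycleIn : ∀ {n} → Graph n → VSet n → Set
CycleIn {n} G S =
  Σ (Fin n) λ x₀ → Σ (List (Fin n)) λ xs → Σ (Fin n) λ xₗ →
    let cyc = x₀ ∷ xs Data.List.++ (xₗ ∷ []) in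
    (2 ≤ length (xs Data.List.++ (xₗ ∷ []))) × Unique cyc × All (λ x → x ∈ᵥ S) cyc
    × Linked (Adj G) cyc × Adj G xₗ x₀

Acyclic : ∀ {n} → Graph n → VSet n → Set
Acyclic G S = ¬ CycleIn G S

IsTree : ∀ {n} → Graph n → VSet n → Set
IsTree G S = (∃ λ x → x ∈ᵥ S) × Connected G S × Acyclic G S

record IsELSS {n} (G : Graph n) (k : ℕ) (F T : VSet n) (w : Fin n → ℕ) : Set where
  field
    T-nonempty : ∃ λ x → x ∈ᵥ T
    F-nonempty : ∃ λ x → x ∈ᵥ F
    T⊆F        : T ⊆ᵥ F
    T-conn     : Connected G T
    w-pos      : ∀ x → 0 < w x

AlmostLeafless : ∀ {n} → Graph n → VSet n → Set
AlmostLeafless G F = ∀ u → deg G u ≡ 1 → ∀ x → (x ∈ᵥ F → x ≡ u) × (x ≡ u → x ∈ᵥ F)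

SecludedSupertree : ∀ {n} → Graph n → ℕ → VSet n → VSet n → Set
SecludedSupertree G k F H = IsTree G H × F ⊆ᵥ H × card (N G H) ≤ k

MaxSecludedSupertree : ∀ {n} → Graph n → ℕ → VSet n → (Fin n → ℕ) → VSet n → Set
MaxSecludedSupertree G k F w H =
  SecludedSupertree G k F H × (∀ H' → SecludedSupertree G k F H' → weight w H' ≤ weight w H)

OnlyNew : ∀ {n} → Graph n → VSet n → Fin n → List (Fin n) → Fin n → Set
OnlyNew G T x vs u =
  ∀ y → (Adj G x y × ¬ (y ∈ᵥ listSet vs) × ¬ (y ∈ᵥ T) → y ≡ u)
      × (y ≡ u → Adj G x y × ¬ (y ∈ᵥ listSet vs) × ¬ (y ∈ᵥ T))

-- Reaches G T v last vs : running the path-growing process from (v) can reach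
-- a path whose last vertex is `last` and whose vertex list (newest first) is vs.
data Reaches {n} (G : Graph n) (T : VSet n) (v : Fin n) : Fin n → List (Fin n) → Set where
  start : Reaches G T v v (v ∷ [])
  grow  : ∀ {x vs u} → Reaches G T v x vs → deg G x ≡ 2 → OnlyNew G T x vs u
        → Reaches G T v u (u ∷ vs)

PathProcess : ∀ {n} → Graph n → VSet n → Fin n → Fin n → List (Fin n) → Set
PathProcess G T v vℓ vs =
  Reaches G T v vℓ vs × ¬ (deg G vℓ ≡ 2 × ∃ λ u → OnlyNew G T vℓ vs u)

ExactlyOne : Set → Set → Set → Set
ExactlyOne A B C = (A × ¬ B × ¬ C) ⊎ (¬ A × B × ¬ C) ⊎ (¬ A × ¬ B × C)

-- Write the path as p 0 = v, …, p L = vℓ. Its inner vertices have degree 2, and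
-- the other neighbour of p 0 lies in T ⊆ H.
--
-- Call p s attached if p (s - 1) ∈ H or s = 0. If p s, …, p e ∉ H with s < e and
-- p s attached, then H ∪ {p s, …, p (e - 1)} is again a tree: the new vertices
-- hang from H along a path whose far end p e stays outside. Its neighbourhood
-- trades p s for p e, and it is heavier than H, contradicting maximality. Hence
-- every path vertex outside H lies in N(H), and no two consecutive ones are
-- outside H. Moreover at most one path vertex is outside H: if p a, p b ∉ H with
-- a < b, then p (a + 1) ∈ H, and a walk in H from p (a + 1) to T cannot get past
-- p a or p b, because the vertices in between have degree 2.

module Submission where

open import Defs
import Data.Bool
open Data.Bool using (true; false; not; _∧_; _∨_; if_then_else_)
open import Data.Bool.Properties
  using (T-≡; not-injective; ¬-not; ∧-identityʳ; ∨-zeroʳ; ∨-conicalˡ; ∧-conicalˡ; ∧-conicalʳ)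
open import Data.Empty using (⊥; ⊥-elim)
open import Data.Fin using (Fin; zero; suc; _≟_)
open import Data.List using (List; []; _∷_; _++_; map; allFin; tabulate)
open import Data.List.Membership.Propositional using (_∈_; lose)
open import Data.List.Membership.Propositional.Properties using (∈-allFin; ∈-++⁺ʳ)
open import Data.List.Properties using (map-tabulate)
open import Data.List.Relation.Unary.All as All using (All)
open import Data.List.Relation.Unary.AllPairs using (_∷_)
open import Data.List.Relation.Unary.Any as Any using (here; there; satisfied)
open import Data.List.Relation.Unary.Any.Properties using (any⁺; any⁻)
open import Data.List.Relation.Unary.Linked using (Linked; _∷_)
open import Data.List.Relation.Unary.Unique.Propositional using (Unique)
open import Data.Nat using (ℕ; zero; suc; _+_; _∸_; _≤_; _<_; z≤n; s≤s)
open import Data.Nat.ListAction using () renaming (sum to listSum)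
open import Data.Nat.Properties hiding (_≟_)
open import Algebra.Properties.CommutativeMonoid.Sum +-0-commutativeMonoid
  using (∑-distrib-+; sum-cong-≗; sum-replicate-zero) renaming (sum to ∑)
open import Data.Product using (∃; ∃₂; _×_; _,_; proj₁; proj₂)
open import Data.Sum as Sum using (_⊎_; inj₁; inj₂)
open import Data.Unit using (⊤; tt)
open import Function using (id; _∘_; const)
open import Function.Bundles using (Equivalence)
open import Relation.Binary using (tri<; tri≈; tri>)
open import Relation.Binary.PropositionalEquality
open import Relation.Nullary using (Dec; yes; no; contradiction; ¬_)
open import Relation.Nullary.Decidable
  using (does; ⌊_⌋; dec-true; dec-false; toWitness; fromWitness; _×-dec_)

dec-true⁻ : ∀ {a} {A : Set a} (a? : Dec A) → does a? ≡ true → A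
dec-true⁻ (yes a) _ = a

∧-true⁻ : ∀ a {b} → a ∧ b ≡ true → a ≡ true × b ≡ true
∧-true⁻ a {b} a∧b = ∧-conicalˡ a b a∧b , ∧-conicalʳ a b a∧b

_∉ᵥ_ : ∀ {n} → Fin n → VSet n → Set
x ∉ᵥ S = S x ≡ false

∈∧∉⇒⊥ : ∀ {n} (S : VSet n) {x} → x ∈ᵥ S → x ∉ᵥ S → ⊥
∈∧∉⇒⊥ S x∈S x∉S with () ← trans (sym x∈S) x∉S

∈∧∉⇒≢ : ∀ {n} (S : VSet n) {x y} → x ∈ᵥ S → y ∉ᵥ S → x ≢ y
∈∧∉⇒≢ S x∈S y∉S refl = ∈∧∉⇒⊥ S x∈S y∉S

_∪_ : ∀ {n} → VSet n → VSet n → VSet n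
(S ∪ S′) x = S x ∨ S′ x

｛_｝ : ∀ {n} → Fin n → VSet n
｛ a ｝ x = does (x ≟ a)

_─_ : ∀ {n} → VSet n → Fin n → VSet n
(S ─ a) x = S x ∧ not (does (x ≟ a))

∈-∪⁺ˡ : ∀ {n} (S S′ : VSet n) {x} → x ∈ᵥ S → x ∈ᵥ (S ∪ S′)
∈-∪⁺ˡ S S′ x∈S rewrite x∈S = refl

∈-∪⁺ʳ : ∀ {n} (S S′ : VSet n) {x} → x ∈ᵥ S′ → x ∈ᵥ (S ∪ S′)
∈-∪⁺ʳ S S′ {x} x∈S′ rewrite x∈S′ = ∨-zeroʳ (S x)

∈-∪⁻ : ∀ {n} (S S′ : VSet n) {x} → x ∈ᵥ (S ∪ S′) → x ∈ᵥ S ⊎ x ∈ᵥ S′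
∈-∪⁻ S S′ {x} x∈S∪S′ with S x
... | true  = inj₁ refl
... | false = inj₂ x∈S∪S′

∈-｛｝ : ∀ {n} (a : Fin n) → a ∈ᵥ ｛ a ｝
∈-｛｝ a = dec-true (a ≟ a) refl

∈-─⁺ : ∀ {n} (S : VSet n) {x a} → x ∈ᵥ S → x ≢ a → x ∈ᵥ (S ─ a)
∈-─⁺ S {x} {a} x∈S x≢a rewrite x∈S | dec-false (x ≟ a) x≢a = refl

_↾_ : ∀ {n} → (Fin n → ℕ) → VSet n → Fin n → ℕ
(f ↾ S) x = if S x then f x else 0

mass : ∀ {n} → (Fin n → ℕ) → VSet n → ℕ
mass f S = ∑ (f ↾ S)

listSum-tabulate : ∀ {n} (f : Fin n → ℕ) → listSum (tabulate f) ≡ ∑ f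
listSum-tabulate {zero}  f = refl
listSum-tabulate {suc n} f = cong (f zero +_) (listSum-tabulate (f ∘ suc))

listSum-allFin : ∀ {n} (f : Fin n → ℕ) → listSum (map f (allFin n)) ≡ ∑ f
listSum-allFin f = trans (cong listSum (map-tabulate id f)) (listSum-tabulate f)

card≡mass : ∀ {n} (S : VSet n) → card S ≡ mass (const 1) S
card≡mass S = listSum-allFin (const 1 ↾ S)

weight≡mass : ∀ {n} (w : Fin n → ℕ) (S : VSet n) → weight w S ≡ mass w S
weight≡mass w S = listSum-allFin (w ↾ S)

∑-mono-≤ : ∀ {n} {f g : Fin n → ℕ} → (∀ x → f x ≤ g x) → ∑ f ≤ ∑ g
∑-mono-≤ {zero}  f≤g = z≤n
∑-mono-≤ {suc n} f≤g = +-mono-≤ (f≤g zero) (∑-mono-≤ (f≤g ∘ suc))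

mass-｛｝ : ∀ {n} (f : Fin n → ℕ) a → mass f ｛ a ｝ ≡ f a
mass-｛｝ {suc n} f zero    = trans (cong (f zero +_) (sum-replicate-zero n)) (+-identityʳ (f zero))
mass-｛｝ {suc n} f (suc a) = mass-｛｝ (f ∘ suc) a

mass-∅ : ∀ {n} (f : Fin n → ℕ) {S : VSet n} → (∀ x → x ∉ᵥ S) → mass f S ≡ 0
mass-∅ {n} f S≡∅ =
  trans (sum-cong-≗ (λ x → cong (λ b → if b then f x else 0) (S≡∅ x))) (sum-replicate-zero n)

mass-mono : ∀ {n} (f : Fin n → ℕ) {S S′ : VSet n} → S ⊆ᵥ S′ → mass f S ≤ mass f S′
mass-mono f {S} {S′} S⊆S′ = ∑-mono-≤ pointwise
  where
  pointwise : ∀ x → (f ↾ S) x ≤ (f ↾ S′) x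
  pointwise x with S x in x∈S
  ... | false = z≤n
  ... | true rewrite S⊆S′ x x∈S = ≤-refl

mass-∪ : ∀ {n} (f : Fin n → ℕ) (S S′ : VSet n) → mass f (S ∪ S′) ≤ mass f S + mass f S′
mass-∪ f S S′ = ≤-trans (∑-mono-≤ pointwise) (≤-reflexive (∑-distrib-+ (f ↾ S) (f ↾ S′)))
  where
  pointwise : ∀ x → (f ↾ (S ∪ S′)) x ≤ (f ↾ S) x + (f ↾ S′) x
  pointwise x with S x | S′ x
  ... | true  | _     = m≤m+n (f x) _
  ... | false | true  = ≤-refl
  ... | false | false = z≤n

mass-─ : ∀ {n} (f : Fin n → ℕ) (S : VSet n) {a} → a ∈ᵥ S → mass f S ≡ f a + mass f (S ─ a)
mass-─ f S {a} a∈S = begin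
  mass f S                       ≡⟨ sum-cong-≗ pointwise ⟩
  ∑ (λ x → (f ↾ ｛ a ｝) x + (f ↾ (S ─ a)) x) ≡⟨ ∑-distrib-+ (f ↾ ｛ a ｝) (f ↾ (S ─ a)) ⟩
  mass f ｛ a ｝ + mass f (S ─ a) ≡⟨ cong (_+ mass f (S ─ a)) (mass-｛｝ f a) ⟩
  f a + mass f (S ─ a)           ∎
  where
  open ≡-Reasoning
  pointwise : ∀ x → (f ↾ S) x ≡ (f ↾ ｛ a ｝) x + (f ↾ (S ─ a)) x
  pointwise x with x ≟ a
  ... | yes refl rewrite a∈S = sym (+-identityʳ (f x))
  ... | no _ rewrite ∧-identityʳ (S x) = refl

card-─ : ∀ {n} (S : VSet n) {a} → a ∈ᵥ S → card S ≡ suc (card (S ─ a))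
card-─ S {a} a∈S =
  trans (card≡mass S) (trans (mass-─ (const 1) S a∈S) (cong suc (sym (card≡mass (S ─ a)))))

∈⇒1≤card : ∀ {n} (S : VSet n) {a} → a ∈ᵥ S → 1 ≤ card S
∈⇒1≤card S a∈S = subst (1 ≤_) (sym (card-─ S a∈S)) (s≤s z≤n)

card≡0⇒∉ : ∀ {n} (S : VSet n) {a} → card S ≡ 0 → ¬ a ∈ᵥ S
card≡0⇒∉ S card≡0 a∈S = 0≢1+n (trans (sym card≡0) (card-─ S a∈S))

∅⇒card≡0 : ∀ {n} (S : VSet n) → (∀ x → x ∉ᵥ S) → card S ≡ 0
∅⇒card≡0 S S≡∅ = trans (card≡mass S) (mass-∅ (const 1) S≡∅)

⊆｛｝⇒card≤1 : ∀ {n} (S : VSet n) {a} → S ⊆ᵥ ｛ a ｝ → card S ≤ 1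
⊆｛｝⇒card≤1 S {a} S⊆a = begin
  card S                ≡⟨ card≡mass S ⟩
  mass (const 1) S      ≤⟨ mass-mono (const 1) S⊆a ⟩
  mass (const 1) ｛ a ｝ ≡⟨ mass-｛｝ (const 1) a ⟩
  1                     ∎
  where open ≤-Reasoning

card≡2⇒⊆pair : ∀ {n} (S : VSet n) {a b c}
  → card S ≡ 2 → a ∈ᵥ S → b ∈ᵥ S → a ≢ b → c ∈ᵥ S → c ≡ a ⊎ c ≡ b
card≡2⇒⊆pair S {a} {b} {c} card≡2 a∈S b∈S a≢b c∈S with c ≟ a | c ≟ b
... | yes c≡a | _       = inj₁ c≡a
... | no _    | yes c≡b = inj₂ c≡b
... | no c≢a  | no c≢b  =
  contradiction (∈-─⁺ (S ─ a) (∈-─⁺ S c∈S c≢a) c≢b) (card≡0⇒∉ ((S ─ a) ─ b) card≡0)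
  where
  card≡1 : card (S ─ a) ≡ 1
  card≡1 = suc-injective (trans (sym (card-─ S a∈S)) card≡2)
  card≡0 : card ((S ─ a) ─ b) ≡ 0
  card≡0 = suc-injective (trans (sym (card-─ (S ─ a) (∈-─⁺ S b∈S (a≢b ∘ sym)))) card≡1)

card-swap : ∀ {n} (S S′ : VSet n) {a b} → S′ ⊆ᵥ ((S ─ a) ∪ ｛ b ｝) → a ∈ᵥ S → card S′ ≤ card S
card-swap S S′ {a} {b} S′⊆ a∈S = begin
  card S′                                   ≡⟨ card≡mass S′ ⟩
  mass (const 1) S′                         ≤⟨ mass-mono (const 1) S′⊆ ⟩
  mass (const 1) ((S ─ a) ∪ ｛ b ｝)          ≤⟨ mass-∪ (const 1) (S ─ a) ｛ b ｝ ⟩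
  mass (const 1) (S ─ a) + mass (const 1) ｛ b ｝
    ≡⟨ cong₂ _+_ (sym (card≡mass (S ─ a))) (mass-｛｝ (const 1) b) ⟩
  card (S ─ a) + 1                          ≡⟨ +-comm (card (S ─ a)) 1 ⟩
  suc (card (S ─ a))                        ≡⟨ card-─ S a∈S ⟨
  card S                                    ∎
  where open ≤-Reasoning

weight-< : ∀ {n} (w : Fin n → ℕ) (S S′ : VSet n) {a}
  → S ⊆ᵥ S′ → a ∈ᵥ S′ → a ∉ᵥ S → 0 < w a → weight w S < weight w S′
weight-< w S S′ {a} S⊆S′ a∈S′ a∉S 0<wa = begin-strict
  weight w S            ≡⟨ weight≡mass w S ⟩
  mass w S              ≤⟨ mass-mono w S⊆S′─a ⟩
  mass w (S′ ─ a)       <⟨ m<n+m _ 0<wa ⟩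
  w a + mass w (S′ ─ a) ≡⟨ mass-─ w S′ a∈S′ ⟨
  mass w S′             ≡⟨ weight≡mass w S′ ⟨
  weight w S′           ∎
  where
  open ≤-Reasoning
  S⊆S′─a : S ⊆ᵥ (S′ ─ a)
  S⊆S′─a x x∈S = ∈-─⁺ S′ (S⊆S′ x x∈S) (∈∧∉⇒≢ S x∈S a∉S)

∈-N⁺ : ∀ {n} (G : Graph n) (S : VSet n) {x y} → y ∉ᵥ S → x ∈ᵥ S → Adj G x y → y ∈ᵥ N G S
∈-N⁺ G S {x} {y} y∉S x∈S x~y rewrite y∉S =
  Equivalence.to T-≡ (any⁺ _ (lose (∈-allFin x) (Equivalence.from T-≡ x∈S∧x~y)))
  where
  x∈S∧x~y : S x ∧ adj G x y ≡ true
  x∈S∧x~y rewrite x∈S = x~y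

∈-N⁻ : ∀ {n} (G : Graph n) (S : VSet n) {y}
  → y ∈ᵥ N G S → y ∉ᵥ S × ∃ λ x → x ∈ᵥ S × Adj G x y
∈-N⁻ {n} G S {y} y∈NS with ∧-true⁻ (not (S y)) y∈NS
... | y∉S , ∃x with satisfied (any⁻ _ (allFin n) (Equivalence.from T-≡ ∃x))
... | x , x∈S∧x~y = not-injective y∉S , x , ∧-true⁻ (S x) (Equivalence.to T-≡ x∈S∧x~y)

∈⇒∈listSet : ∀ {n} {vs : List (Fin n)} {y} → y ∈ vs → y ∈ᵥ listSet vs
∈⇒∈listSet y∈vs = Equivalence.to T-≡ (any⁺ _ (Any.map (λ { refl → fromWitness refl }) y∈vs))

∈listSet⇒∈ : ∀ {n} (vs : List (Fin n)) {y} → y ∈ᵥ listSet vs → y ∈ vs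
∈listSet⇒∈ vs y∈vs = Any.map (λ y≟z → sym (toWitness y≟z)) (any⁻ _ vs (Equivalence.from T-≡ y∈vs))

Adj-sym : ∀ {n} (G : Graph n) {x y} → Adj G x y → Adj G y x
Adj-sym G {x} {y} x~y = trans (adj-sym G y x) x~y

Adj-irrefl : ∀ {n} (G : Graph n) {x y} → Adj G x y → x ≢ y
Adj-irrefl G {x} x~x refl with () ← trans (sym x~x) (adj-irr G x)

module _ {n} {G : Graph n} where

  Walk-source : ∀ {S x y} → Walk G S x y → x ∈ᵥ S
  Walk-source (here x∈S)     = x∈S
  Walk-source (step x∈S _ _) = x∈S

  Walk-mono : ∀ {S S′} → S ⊆ᵥ S′ → ∀ {x y} → Walk G S x y → Walk G S′ x y
  Walk-mono S⊆S′ (here x∈S)          = here (S⊆S′ _ x∈S)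
  Walk-mono S⊆S′ (step x∈S x~y walk) = step (S⊆S′ _ x∈S) x~y (Walk-mono S⊆S′ walk)

  Walk-++ : ∀ {S x y z} → Walk G S x y → Walk G S y z → Walk G S x z
  Walk-++ (here _)            walk′ = walk′
  Walk-++ (step x∈S x~y walk) walk′ = step x∈S x~y (Walk-++ walk walk′)

  Walk-reverse : ∀ {S x y} → Walk G S x y → Walk G S y x
  Walk-reverse (here x∈S)          = here x∈S
  Walk-reverse (step x∈S x~y walk) =
    Walk-++ (Walk-reverse walk) (step (Walk-source walk) (Adj-sym G x~y) (here x∈S))

module _ {n} (G : Graph n) where

  TwoNeighboursIn : Fin n → List (Fin n) → Set
  TwoNeighboursIn x c = ∃₂ λ a b → a ∈ c × b ∈ c × a ≢ b × Adj G x a × Adj G x b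

  successor : ∀ y (q : List (Fin n)) e → Linked (Adj G) (y ∷ q ++ e ∷ [])
            → ∃ λ b → b ∈ q ++ e ∷ [] × Adj G y b
  successor y []      e (y~e ∷ _) = e , here refl , y~e
  successor y (z ∷ q) e (y~z ∷ _) = z , here refl , y~z

  -- z ∷ q ++ e ∷ [] is a stretch of the cycle c that ends just before x₀
  two-neighbours-in-stretch : ∀ c x₀ → x₀ ∈ c → ∀ z (q : List (Fin n)) e
    → (∀ {x} → x ∈ z ∷ q ++ e ∷ [] → x ∈ c) → All (_≢ x₀) (z ∷ q ++ e ∷ [])
    → Linked (Adj G) (z ∷ q ++ e ∷ []) → Unique (z ∷ q ++ e ∷ []) → Adj G e x₀
    → ∀ {x} → x ∈ q ++ e ∷ [] → TwoNeighboursIn x c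
  two-neighbours-in-stretch c x₀ x₀∈c z [] e ⊆c (z≢x₀ All.∷ _) (z~e ∷ _) _ e~x₀ (here refl) =
    z , x₀ , ⊆c (here refl) , x₀∈c , z≢x₀ , Adj-sym G z~e , e~x₀
  two-neighbours-in-stretch c x₀ x₀∈c z (y ∷ q) e ⊆c _ (z~y ∷ linked) (z∉ ∷ _) _ (here refl)
    with successor y q e linked
  ... | b , b∈ , y~b =
    z , b , ⊆c (here refl) , ⊆c (there (there b∈)) , All.lookup z∉ (there b∈) , Adj-sym G z~y , y~b
  two-neighbours-in-stretch c x₀ x₀∈c z (y ∷ q) e ⊆c (_ All.∷ ≢x₀) (_ ∷ linked) (_ ∷ unique) e~x₀
                            (there x∈) =
    two-neighbours-in-stretch c x₀ x₀∈c y q e (⊆c ∘ there) ≢x₀ linked unique e~x₀ x∈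

module _ {n} (G : Graph n) (S : VSet n) where

  vertices : CycleIn G S → List (Fin n)
  vertices (x₀ , xs , xₗ , _) = x₀ ∷ xs ++ xₗ ∷ []

  cycle-two-neighbours : (C : CycleIn G S) → ∀ {x} → x ∈ vertices C → TwoNeighboursIn G x (vertices C)
  cycle-two-neighbours (x₀ , [] , xₗ , s≤s () , _)
  cycle-two-neighbours (x₀ , y ∷ ys , xₗ , _ , (_ ∷ y∉ ∷ _) , _ , (x₀~y ∷ _) , xₗ~x₀) (here refl) =
    xₗ , y , there (∈-++⁺ʳ (y ∷ ys) (here refl)) , there (here refl) ,
    (λ xₗ≡y → All.lookup y∉ (∈-++⁺ʳ ys (here refl)) (sym xₗ≡y)) , Adj-sym G xₗ~x₀ , x₀~y
  cycle-two-neighbours (x₀ , y ∷ ys , xₗ , _ , (x₀∉ ∷ _) , _ , (x₀~y ∷ linked) , _) (there (here refl))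
    with successor G y ys xₗ linked
  ... | b , b∈ , y~b =
    x₀ , b , here refl , there (there b∈) , All.lookup x₀∉ (there b∈) , Adj-sym G x₀~y , y~b
  cycle-two-neighbours (x₀ , y ∷ ys , xₗ , _ , (x₀∉ ∷ unique) , _ , (_ ∷ linked) , xₗ~x₀)
                       (there (there x∈)) =
    two-neighbours-in-stretch G (x₀ ∷ y ∷ ys ++ xₗ ∷ []) x₀ (here refl) y ys xₗ there
      (All.map (_∘ sym) x₀∉) linked unique xₗ~x₀ x∈

  deg2-cycle-closed : (C : CycleIn G S) → ∀ {x y}
    → x ∈ vertices C → deg G x ≡ 2 → Adj G x y → y ∈ vertices C
  deg2-cycle-closed C {x} x∈ deg≡2 x~y with cycle-two-neighbours C x∈
  ... | a , b , a∈ , b∈ , a≢b , x~a , x~b with card≡2⇒⊆pair (nbr G x) deg≡2 x~a x~b a≢b x~y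
  ... | inj₁ refl = a∈
  ... | inj₂ refl = b∈

-- No cycle inside S passes through a vertex that escapes S.
data Escapes {n} (G : Graph n) (S : VSet n) (x : Fin n) : Set where
  exit : ∀ {y} → deg G x ≡ 2 → Adj G x y → y ∉ᵥ S → Escapes G S x
  next : ∀ {y} → deg G x ≡ 2 → Adj G x y → Escapes G S y → Escapes G S x

module _ {n} {G : Graph n} where

  Connected-extend : ∀ {S S′ : VSet n} → S ⊆ᵥ S′ → Connected G S
    → (∀ x → x ∈ᵥ S′ → ∃ λ h → h ∈ᵥ S × Walk G S′ x h) → Connected G S′
  Connected-extend S⊆S′ S-connected reach x y x∈S′ y∈S′ with reach x x∈S′ | reach y y∈S′
  ... | hx , hx∈S , x⇝hx | hy , hy∈S , y⇝hy =
    Walk-++ x⇝hx (Walk-++ (Walk-mono S⊆S′ (S-connected hx hy hx∈S hy∈S)) (Walk-reverse y⇝hy))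

  Acyclic-extend : ∀ {S S′ : VSet n} → S ⊆ᵥ S′ → Acyclic G S
    → (∀ x → x ∈ᵥ S′ → x ∉ᵥ S → Escapes G S′ x) → Acyclic G S′
  Acyclic-extend {S} {S′} S⊆S′ S-acyclic escapes
                 C@(x₀ , xs , xₗ , long , unique , ⊆S′ , linked , closing) =
    S-acyclic (x₀ , xs , xₗ , long , unique , All.tabulate on-cycle⇒∈S , linked , closing)
    where
    cycle : List (Fin n)
    cycle = vertices G S′ C

    closed : ∀ {x y} → x ∈ cycle → deg G x ≡ 2 → Adj G x y → y ∈ cycle
    closed = deg2-cycle-closed G S′ C

    off-cycle : ∀ {x} → Escapes G S′ x → ¬ x ∈ cycle
    off-cycle (exit deg≡2 x~y y∉S′)      x∈ = ∈∧∉⇒⊥ S′ (All.lookup ⊆S′ (closed x∈ deg≡2 x~y)) y∉S′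
    off-cycle (next deg≡2 x~y y-escapes) x∈ = off-cycle y-escapes (closed x∈ deg≡2 x~y)

    on-cycle⇒∈S : ∀ {x} → x ∈ cycle → x ∈ᵥ S
    on-cycle⇒∈S {x} x∈ with S x in x∈S?
    ... | true  = refl
    ... | false = contradiction x∈ (off-cycle (escapes x (All.lookup ⊆S′ x∈) x∈S?))

MaxSecluded-no-extension : ∀ {n} {G : Graph n} {k F w H H′} → MaxSecludedSupertree G k F w H
  → (∀ x → 0 < w x) → H ⊆ᵥ H′ → IsTree G H′ → card (N G H′) ≤ card (N G H)
  → ∀ {a} → a ∈ᵥ H′ → a ∉ᵥ H → ⊥
MaxSecluded-no-extension {w = w} {H} {H′} ((_ , F⊆H , |NH|≤k) , maximal)
                         w-pos H⊆H′ H′-tree |NH′|≤|NH| a∈H′ a∉H =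
  <⇒≱ (weight-< w H H′ H⊆H′ a∈H′ a∉H (w-pos _))
      (maximal H′ (H′-tree , (λ x x∈F → H⊆H′ x (F⊆H x x∈F)) , ≤-trans |NH′|≤|NH| |NH|≤k))

-- The vertices of T play the role of p (0 - 1).
Preceding : ∀ {n} → VSet n → (ℕ → Fin n) → ℕ → Fin n → Set
Preceding T p zero    y = y ∈ᵥ T
Preceding T p (suc j) y = y ≡ p j

record IndexedPath {n} (G : Graph n) (T : VSet n) (v x : Fin n) (vs : List (Fin n)) : Set where
  field
    L          : ℕ
    p          : ℕ → Fin n
    p-first    : p 0 ≡ v
    p-last     : p L ≡ x
    ∈⇒index    : ∀ {y} → y ∈ vs → ∃ λ i → i ≤ L × p i ≡ y
    index⇒∈    : ∀ {i} → i ≤ L → p i ∈ vs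
    ∉T         : ∀ {i} → i ≤ L → p i ∉ᵥ T
    adjacent   : ∀ {i} → i < L → Adj G (p i) (p (suc i))
    deg≡2      : ∀ {i} → i < L → deg G (p i) ≡ 2
    neighbours : ∀ {i y} → i < L → Adj G (p i) y → y ≡ p (suc i) ⊎ Preceding T p i y
    injective  : ∀ {i j} → i ≤ L → j ≤ L → p i ≡ p j → i ≡ j

extend : ∀ {n} → (ℕ → Fin n) → ℕ → Fin n → ℕ → Fin n
extend p L u i with i ≤? L
... | yes _ = p i
... | no  _ = u

extend-≤ : ∀ {n} (p : ℕ → Fin n) {L} u {i} → i ≤ L → extend p L u i ≡ p i
extend-≤ p {L} u {i} i≤L with i ≤? L
... | yes _   = refl
... | no  i≰L = contradiction i≤L i≰L

extend-suc : ∀ {n} (p : ℕ → Fin n) L u → extend p L u (suc L) ≡ u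
extend-suc p L u with suc L ≤? L
... | yes 1+L≤L = contradiction 1+L≤L 1+n≰n
... | no  _     = refl

≤-suc-cases : ∀ {i L} → i ≤ suc L → i ≤ L ⊎ i ≡ suc L
≤-suc-cases i≤1+L with m≤n⇒m<n∨m≡n i≤1+L
... | inj₁ (s≤s i≤L) = inj₁ i≤L
... | inj₂ i≡1+L     = inj₂ i≡1+L

module _ {n} {G : Graph n} {T : VSet n} where

  IndexedPath-start : ∀ {v} → v ∈ᵥ N G T → IndexedPath G T v v (v ∷ [])
  IndexedPath-start {v} v∈NT = record
    { L = 0 ; p = const v ; p-first = refl ; p-last = refl
    ; ∈⇒index = λ { (here refl) → 0 , z≤n , refl }
    ; index⇒∈ = λ _ → here refl
    ; ∉T = λ _ → proj₁ (∈-N⁻ G T v∈NT)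
    ; adjacent = λ () ; deg≡2 = λ () ; neighbours = λ ()
    ; injective = λ { z≤n z≤n _ → refl } }

  module Grow {v x vs u} (path : IndexedPath G T v x vs) (deg-x≡2 : deg G x ≡ 2)
              (only-new : OnlyNew G T x vs u) where

    open IndexedPath path public

    p′ : ℕ → Fin n
    p′ = extend p L u

    p′≡p : ∀ {i} → i ≤ L → p′ i ≡ p i
    p′≡p = extend-≤ p u

    p′-last : p′ (suc L) ≡ u
    p′-last = extend-suc p L u

    x~u : Adj G x u
    x~u = proj₁ (proj₂ (only-new u) refl)

    u∉vs : ¬ u ∈ vs
    u∉vs = proj₁ (proj₂ (proj₂ (only-new u) refl)) ∘ ∈⇒∈listSet

    u∉T : u ∉ᵥ T
    u∉T = ¬-not (proj₂ (proj₂ (proj₂ (only-new u) refl)))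

    last-neighbours : ∀ {y} → Adj G x y → y ≡ u ⊎ Preceding T p L y
    last-neighbours {y} x~y with L in L≡
    ... | zero with T y in y∈T? | listSet vs y in y∈vs?
    ...   | true  | _     = inj₂ refl
    ...   | false | false =
      inj₁ (proj₁ (only-new y) (x~y , (λ y∈vs → ∈∧∉⇒⊥ (listSet vs) y∈vs y∈vs?)
                                    , (λ y∈T → ∈∧∉⇒⊥ T y∈T y∈T?)))
    ...   | false | true  with ∈⇒index (∈listSet⇒∈ vs y∈vs?)
    ...     | j , j≤L , pj≡y = contradiction (trans (sym p-last) (trans (cong p L≡j) pj≡y)) (Adj-irrefl G x~y)
      where
      L≡j : L ≡ j
      L≡j = trans L≡ (sym (n≤0⇒n≡0 (subst (j ≤_) L≡ j≤L)))
    last-neighbours {y} x~y | suc ℓ = Sum.swap (card≡2⇒⊆pair (nbr G x) deg-x≡2 x~pℓ x~u pℓ≢u x~y)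
      where
      ℓ<L : ℓ < L
      ℓ<L = subst (ℓ <_) (sym L≡) ≤-refl
      x~pℓ : Adj G x (p ℓ)
      x~pℓ = Adj-sym G (subst (Adj G (p ℓ)) (trans (cong p (sym L≡)) p-last) (adjacent ℓ<L))
      pℓ≢u : p ℓ ≢ u
      pℓ≢u pℓ≡u = u∉vs (subst (_∈ vs) pℓ≡u (index⇒∈ (<⇒≤ ℓ<L)))

    preceding′ : ∀ {i y} → i ≤ L → Preceding T p i y → Preceding T p′ i y
    preceding′ {zero}  _   y∈T  = y∈T
    preceding′ {suc j} j<L y≡pj = trans y≡pj (sym (p′≡p (<⇒≤ j<L)))

    ∈⇒index′ : ∀ {y} → y ∈ u ∷ vs → ∃ λ i → i ≤ suc L × p′ i ≡ y
    ∈⇒index′ (here refl)  = suc L , ≤-refl , p′-last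
    ∈⇒index′ (there y∈vs) with ∈⇒index y∈vs
    ... | i , i≤L , pi≡y  = i , m≤n⇒m≤1+n i≤L , trans (p′≡p i≤L) pi≡y

    index⇒∈′ : ∀ {i} → i ≤ suc L → p′ i ∈ u ∷ vs
    index⇒∈′ i≤1+L with ≤-suc-cases i≤1+L
    ... | inj₁ i≤L  rewrite p′≡p i≤L = there (index⇒∈ i≤L)
    ... | inj₂ refl rewrite p′-last  = here refl

    ∉T′ : ∀ {i} → i ≤ suc L → p′ i ∉ᵥ T
    ∉T′ i≤1+L with ≤-suc-cases i≤1+L
    ... | inj₁ i≤L  rewrite p′≡p i≤L = ∉T i≤L
    ... | inj₂ refl rewrite p′-last  = u∉T

    adjacent′ : ∀ {i} → i < suc L → Adj G (p′ i) (p′ (suc i))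
    adjacent′ (s≤s i≤L) with m≤n⇒m<n∨m≡n i≤L
    ... | inj₁ i<L  rewrite p′≡p i≤L | p′≡p i<L = adjacent i<L
    ... | inj₂ refl rewrite p′≡p i≤L | p′-last | p-last = x~u

    deg≡2′ : ∀ {i} → i < suc L → deg G (p′ i) ≡ 2
    deg≡2′ (s≤s i≤L) with m≤n⇒m<n∨m≡n i≤L
    ... | inj₁ i<L  rewrite p′≡p i≤L = deg≡2 i<L
    ... | inj₂ refl rewrite p′≡p i≤L | p-last = deg-x≡2

    neighbours′ : ∀ {i y} → i < suc L → Adj G (p′ i) y → y ≡ p′ (suc i) ⊎ Preceding T p′ i y
    neighbours′ (s≤s i≤L) i~y with m≤n⇒m<n∨m≡n i≤L
    ... | inj₁ i<L  rewrite p′≡p i≤L | p′≡p i<L = Sum.map₂ (preceding′ i≤L) (neighbours i<L i~y)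
    ... | inj₂ refl rewrite p′≡p i≤L | p′-last | p-last =
      Sum.map₂ (preceding′ ≤-refl) (last-neighbours i~y)

    u-old⇒u∈vs : ∀ {k} → k ≤ L → p′ k ≡ u → u ∈ vs
    u-old⇒u∈vs k≤L p′k≡u = subst (_∈ vs) (trans (sym (p′≡p k≤L)) p′k≡u) (index⇒∈ k≤L)

    injective′ : ∀ {i j} → i ≤ suc L → j ≤ suc L → p′ i ≡ p′ j → i ≡ j
    injective′ i≤1+L j≤1+L p′i≡p′j with ≤-suc-cases i≤1+L | ≤-suc-cases j≤1+L
    ... | inj₁ i≤L  | inj₁ j≤L  =
      injective i≤L j≤L (trans (sym (p′≡p i≤L)) (trans p′i≡p′j (p′≡p j≤L)))
    ... | inj₂ refl | inj₂ refl = refl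
    ... | inj₁ i≤L  | inj₂ refl = contradiction (u-old⇒u∈vs i≤L (trans p′i≡p′j p′-last)) u∉vs
    ... | inj₂ refl | inj₁ j≤L  = contradiction (u-old⇒u∈vs j≤L (trans (sym p′i≡p′j) p′-last)) u∉vs

  IndexedPath-grow : ∀ {v x vs u} → IndexedPath G T v x vs → deg G x ≡ 2 → OnlyNew G T x vs u
                   → IndexedPath G T v u (u ∷ vs)
  IndexedPath-grow path deg-x≡2 only-new = record
    { L = suc L ; p = p′ ; p-first = trans (p′≡p z≤n) p-first ; p-last = p′-last
    ; ∈⇒index = ∈⇒index′ ; index⇒∈ = index⇒∈′ ; ∉T = ∉T′
    ; adjacent = adjacent′ ; deg≡2 = deg≡2′ ; neighbours = neighbours′ ; injective = injective′ }
    where open Grow path deg-x≡2 only-new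

  indexedPath : ∀ {v x vs} → v ∈ᵥ N G T → Reaches G T v x vs → IndexedPath G T v x vs
  indexedPath v∈NT start                      = IndexedPath-start v∈NT
  indexedPath v∈NT (grow path deg≡2 only-new) = IndexedPath-grow (indexedPath v∈NT path) deg≡2 only-new

segment : ∀ {n} → (ℕ → Fin n) → ℕ → ℕ → VSet n
segment p s e y = does (anyUpTo? (λ j → (s ≤? j) ×-dec (p j ≟ y)) e)

segment⁺ : ∀ {n} (p : ℕ → Fin n) {s e j} → s ≤ j → j < e → p j ∈ᵥ segment p s e
segment⁺ p {s} {e} {j} s≤j j<e =
  dec-true (anyUpTo? (λ i → (s ≤? i) ×-dec (p i ≟ p j)) e) (j , j<e , s≤j , refl)

segment⁻ : ∀ {n} (p : ℕ → Fin n) {s e} y → y ∈ᵥ segment p s e → ∃ λ j → j < e × s ≤ j × p j ≡ y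
segment⁻ p {s} {e} y = dec-true⁻ (anyUpTo? (λ j → (s ≤? j) ×-dec (p j ≟ y)) e)

module Trichotomy {n} {G : Graph n} {k : ℕ} {F T : VSet n} {w : Fin n → ℕ} (elss : IsELSS G k F T w)
  {v vℓ : Fin n} {P : List (Fin n)} (v∈NT : v ∈ᵥ N G T) (reach : Reaches G T v vℓ P)
  {H : VSet n} (H-max : MaxSecludedSupertree G k F w H) where

  open IndexedPath (indexedPath v∈NT reach)
  open IsELSS elss using (T⊆F; w-pos)

  H-tree : IsTree G H
  H-tree = proj₁ (proj₁ H-max)

  F⊆H : F ⊆ᵥ H
  F⊆H = proj₁ (proj₂ (proj₁ H-max))

  T⊆H : T ⊆ᵥ H
  T⊆H x x∈T = F⊆H x (T⊆F x x∈T)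

  p∈P : ∀ {i} → i ≤ L → p i ∈ᵥ listSet P
  p∈P i≤L = ∈⇒∈listSet (index⇒∈ i≤L)

  Attached : ℕ → Set
  Attached zero    = ⊤
  Attached (suc j) = p j ∈ᵥ H

  attachment : ∀ {j} → j ≤ L → Attached j → ∃ λ a → a ∈ᵥ H × Adj G (p j) a
  attachment {zero}  _   _ with ∈-N⁻ G T v∈NT
  ... | _ , t , t∈T , t~v = t , T⊆H t t∈T , Adj-sym G (subst (Adj G t) (sym p-first) t~v)
  attachment {suc j} j<L pj∈H = p j , pj∈H , Adj-sym G (adjacent j<L)

  attached⇒∈N : ∀ {j} → j ≤ L → Attached j → p j ∉ᵥ H → p j ∈ᵥ N G H
  attached⇒∈N j≤L attached pj∉H with attachment j≤L attached
  ... | a , a∈H , pj~a = ∈-N⁺ G H pj∉H a∈H (Adj-sym G pj~a)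

  Outside : ℕ → ℕ → Set
  Outside s e = ∀ {j} → s ≤ j → j ≤ e → p j ∉ᵥ H

  module Extension {s e} (s<e : s < e) (e≤L : e ≤ L) (attached : Attached s) (outside : Outside s e) where

    H′ : VSet n
    H′ = H ∪ segment p s e

    H⊆H′ : H ⊆ᵥ H′
    H⊆H′ _ = ∈-∪⁺ˡ H (segment p s e)

    segment⊆H′ : segment p s e ⊆ᵥ H′
    segment⊆H′ _ = ∈-∪⁺ʳ H (segment p s e)

    ps∈H′ : p s ∈ᵥ H′
    ps∈H′ = segment⊆H′ _ (segment⁺ p ≤-refl s<e)

    ps∉H : p s ∉ᵥ H
    ps∉H = outside ≤-refl (<⇒≤ s<e)

    pe∉H′ : p e ∉ᵥ H′
    pe∉H′ with segment p s e (p e) in pe∈segment?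
    ... | false rewrite outside (<⇒≤ s<e) ≤-refl = refl
    ... | true with segment⁻ p (p e) pe∈segment?
    ...   | j , j<e , _ , pj≡pe = contradiction (injective (<⇒≤ (<-≤-trans j<e e≤L)) e≤L pj≡pe) (<⇒≢ j<e)

    preceding∈H′ : ∀ {j y} → s ≤ j → j < e → Preceding T p j y → y ∈ᵥ H′
    preceding∈H′ {zero}  _     _     y∈T  = H⊆H′ _ (T⊆H _ y∈T)
    preceding∈H′ {suc j} s≤1+j 1+j<e refl with m≤n⇒m<n∨m≡n s≤1+j
    ... | inj₁ (s≤s s≤j) = segment⊆H′ _ (segment⁺ p s≤j (<-trans (n<1+n j) 1+j<e))
    ... | inj₂ refl      = H⊆H′ _ attached

    walk-to-attachment : ∀ r → r + s < e → ∃ λ a → a ∈ᵥ H × Walk G H′ (p (r + s)) a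
    walk-to-attachment zero    _ with attachment (<⇒≤ (<-≤-trans s<e e≤L)) attached
    ... | a , a∈H , ps~a = a , a∈H , step ps∈H′ ps~a (here (H⊆H′ a a∈H))
    walk-to-attachment (suc r) 1+r+s<e with walk-to-attachment r (<-trans (n<1+n (r + s)) 1+r+s<e)
    ... | a , a∈H , walk = a , a∈H , step (segment⊆H′ _ (segment⁺ p (m≤n+m s (suc r)) 1+r+s<e)) back walk
      where
      back : Adj G (p (suc r + s)) (p (r + s))
      back = Adj-sym G (adjacent (<-≤-trans (n<1+n (r + s)) (<⇒≤ (<-≤-trans 1+r+s<e e≤L))))

    H′-connected : Connected G H′
    H′-connected = Connected-extend H⊆H′ (proj₁ (proj₂ H-tree)) reach-H
      where
      reach-H : ∀ x → x ∈ᵥ H′ → ∃ λ a → a ∈ᵥ H × Walk G H′ x a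
      reach-H x x∈H′ with ∈-∪⁻ H (segment p s e) x∈H′
      ... | inj₁ x∈H = x , x∈H , here x∈H′
      ... | inj₂ x∈segment with segment⁻ p x x∈segment
      ...   | j , j<e , s≤j , refl with walk-to-attachment (j ∸ s) (subst (_< e) (sym (m∸n+n≡m s≤j)) j<e)
      ...     | a , a∈H , walk = a , a∈H , subst (λ i → Walk G H′ (p i) a) (m∸n+n≡m s≤j) walk

    escapes : ∀ r {j} → suc j + r ≡ e → Escapes G H′ (p j)
    escapes zero {j} 1+j+0≡e =
      exit (deg≡2 j<L) (adjacent j<L) (subst (λ i → p i ∉ᵥ H′) (sym 1+j≡e) pe∉H′)
      where
      1+j≡e = trans (sym (+-identityʳ (suc j))) 1+j+0≡e
      j<L = <-≤-trans (subst (j <_) 1+j≡e ≤-refl) e≤L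
    escapes (suc r) {j} 1+j+1+r≡e =
      next (deg≡2 j<L) (adjacent j<L) (escapes r (trans (sym (+-suc (suc j) r)) 1+j+1+r≡e))
      where
      j<L = <-≤-trans (subst (j <_) 1+j+1+r≡e (m≤m+n (suc j) (suc r))) e≤L

    H′-acyclic : Acyclic G H′
    H′-acyclic = Acyclic-extend H⊆H′ (proj₂ (proj₂ H-tree)) escapes-H
      where
      escapes-H : ∀ x → x ∈ᵥ H′ → x ∉ᵥ H → Escapes G H′ x
      escapes-H x x∈H′ x∉H with ∈-∪⁻ H (segment p s e) x∈H′
      ... | inj₁ x∈H = ⊥-elim (∈∧∉⇒⊥ H x∈H x∉H)
      ... | inj₂ x∈segment with segment⁻ p x x∈segment
      ...   | j , j<e , _ , refl = escapes (e ∸ suc j) (m+[n∸m]≡n j<e)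

    H′-tree : IsTree G H′
    H′-tree = (p s , ps∈H′) , H′-connected , H′-acyclic

    NH′⊆ : N G H′ ⊆ᵥ ((N G H ─ p s) ∪ ｛ p e ｝)
    NH′⊆ y y∈NH′ with ∈-N⁻ G H′ y∈NH′
    ... | y∉H′ , x , x∈H′ , x~y with ∈-∪⁻ H (segment p s e) x∈H′
    ...   | inj₁ x∈H =
      ∈-∪⁺ˡ (N G H ─ p s) ｛ p e ｝ (∈-─⁺ (N G H) y∈NH (∈∧∉⇒≢ H′ ps∈H′ y∉H′ ∘ sym))
      where y∈NH = ∈-N⁺ G H (∨-conicalˡ (H y) _ y∉H′) x∈H x~y
    ...   | inj₂ x∈segment with segment⁻ p x x∈segment
    ...     | j , j<e , s≤j , refl with neighbours (<-≤-trans j<e e≤L) x~y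
    ...       | inj₂ preceding = ⊥-elim (∈∧∉⇒⊥ H′ (preceding∈H′ s≤j j<e preceding) y∉H′)
    ...       | inj₁ refl with m≤n⇒m<n∨m≡n j<e
    ...         | inj₁ 1+j<e = ⊥-elim (∈∧∉⇒⊥ H′ (segment⊆H′ _ (segment⁺ p (m≤n⇒m≤1+n s≤j) 1+j<e)) y∉H′)
    ...         | inj₂ refl  = ∈-∪⁺ʳ (N G H ─ p s) ｛ p e ｝ (∈-｛｝ (p e))

    |NH′|≤|NH| : card (N G H′) ≤ card (N G H)
    |NH′|≤|NH| = card-swap (N G H) (N G H′) NH′⊆ (attached⇒∈N (<⇒≤ (<-≤-trans s<e e≤L)) attached ps∉H)

  no-long-run : ∀ {s e} → s < e → e ≤ L → Attached s → Outside s e → ⊥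
  no-long-run s<e e≤L attached outside =
    MaxSecluded-no-extension H-max w-pos H⊆H′ H′-tree |NH′|≤|NH| ps∈H′ ps∉H
    where open Extension s<e e≤L attached outside

  Outside-single : ∀ {i} → p i ∉ᵥ H → Outside i i
  Outside-single pi∉H i≤j j≤i = subst (λ j → p j ∉ᵥ H) (≤-antisym i≤j j≤i) pi∉H

  Outside-extend : ∀ {s i} → Outside s i → p (suc i) ∉ᵥ H → Outside s (suc i)
  Outside-extend outside p1+i∉H s≤j j≤1+i with ≤-suc-cases j≤1+i
  ... | inj₁ j≤i  = outside s≤j j≤i
  ... | inj₂ refl = p1+i∉H

  run-start : ∀ i → p i ∉ᵥ H → ∃ λ s → s ≤ i × Attached s × Outside s i
  run-start zero    p0∉H   = 0 , z≤n , tt , Outside-single p0∉H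
  run-start (suc i) p1+i∉H with H (p i) in pi∈H?
  ... | true  = suc i , ≤-refl , pi∈H? , Outside-single p1+i∉H
  ... | false with run-start i pi∈H?
  ...   | s , s≤i , attached , outside = s , m≤n⇒m≤1+n s≤i , attached , Outside-extend outside p1+i∉H

  outside⇒∈N : ∀ {i} → i ≤ L → p i ∉ᵥ H → p i ∈ᵥ N G H
  outside⇒∈N {i} i≤L pi∉H with run-start i pi∉H
  ... | s , s≤i , attached , outside with m≤n⇒m<n∨m≡n s≤i
  ...   | inj₁ s<i  = ⊥-elim (no-long-run s<i i≤L attached outside)
  ...   | inj₂ refl = attached⇒∈N i≤L attached pi∉H

  no-consecutive-outside : ∀ {i} → i < L → p i ∉ᵥ H → p (suc i) ∉ᵥ H → ⊥
  no-consecutive-outside {i} i<L pi∉H p1+i∉H with run-start i pi∉H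
  ... | s , s≤i , attached , outside = no-long-run (s≤s s≤i) i<L attached (Outside-extend outside p1+i∉H)

  no-walk-to-T-between : ∀ {lo i hi b} → lo < i → i < hi → hi ≤ L → p lo ∉ᵥ H → p hi ∉ᵥ H
    → Walk G H (p i) b → ¬ b ∈ᵥ T
  no-walk-to-T-between {i = suc j} _ 1+j<hi hi≤L _ _ (here _) b∈T =
    ∈∧∉⇒⊥ T b∈T (∉T (<⇒≤ (<-≤-trans 1+j<hi hi≤L)))
  no-walk-to-T-between {i = suc j} lo<1+j 1+j<hi hi≤L plo∉H phi∉H (step _ p1+j~y walk) b∈T
    with neighbours (<-≤-trans 1+j<hi hi≤L) p1+j~y
  ... | inj₁ refl with m≤n⇒m<n∨m≡n 1+j<hi
  ...   | inj₁ 2+j<hi =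
    no-walk-to-T-between (<-trans lo<1+j (n<1+n (suc j))) 2+j<hi hi≤L plo∉H phi∉H walk b∈T
  ...   | inj₂ refl   = ∈∧∉⇒⊥ H (Walk-source walk) phi∉H
  no-walk-to-T-between {i = suc j} (s≤s lo≤j) 1+j<hi hi≤L plo∉H phi∉H (step _ _ walk) b∈T
    | inj₂ refl with m≤n⇒m<n∨m≡n lo≤j
  ...   | inj₁ lo<j =
    no-walk-to-T-between lo<j (<-trans (n<1+n j) 1+j<hi) hi≤L plo∉H phi∉H walk b∈T
  ...   | inj₂ refl = ∈∧∉⇒⊥ H (Walk-source walk) plo∉H

  outside-unique-< : ∀ {a b} → a < b → b ≤ L → p a ∉ᵥ H → p b ∉ᵥ H → ⊥
  outside-unique-< {a} {b} a<b b≤L pa∉H pb∉H with H (p (suc a)) in p1+a∈H?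
  ... | false = no-consecutive-outside (<-≤-trans a<b b≤L) pa∉H p1+a∈H?
  ... | true with ∈-N⁻ G T v∈NT
  ...   | _ , t , t∈T , _ = no-walk-to-T-between (n<1+n a) 1+a<b b≤L pa∉H pb∉H walk t∈T
    where
    1+a<b : suc a < b
    1+a<b = ≤∧≢⇒< a<b λ 1+a≡b → ∈∧∉⇒⊥ H p1+a∈H? (subst (λ i → p i ∉ᵥ H) (sym 1+a≡b) pb∉H)
    walk : Walk G H (p (suc a)) t
    walk = proj₁ (proj₂ H-tree) (p (suc a)) t p1+a∈H? (T⊆H t t∈T)

  outside-unique : ∀ {a b} → a ≤ L → b ≤ L → p a ∉ᵥ H → p b ∉ᵥ H → a ≡ b
  outside-unique {a} {b} a≤L b≤L pa∉H pb∉H with <-cmp a b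
  ... | tri< a<b _ _ = ⊥-elim (outside-unique-< a<b b≤L pa∉H pb∉H)
  ... | tri≈ _ a≡b _ = a≡b
  ... | tri> _ _ b<a = ⊥-elim (outside-unique-< b<a a≤L pb∉H pa∉H)

  gaps : VSet n
  gaps y = N G H y ∧ listSet P y ∧ not (F y) ∧ not ⌊ y ≟ vℓ ⌋

  gaps⊆path∖H : ∀ {y} → y ∈ᵥ gaps → ∃ λ i → i ≤ L × p i ≡ y × p i ∉ᵥ H
  gaps⊆path∖H {y} y∈gaps with ∧-true⁻ (N G H y) y∈gaps
  ... | y∈NH , rest with ∈⇒index (∈listSet⇒∈ P (proj₁ (∧-true⁻ (listSet P y) rest)))
  ...   | i , i≤L , refl = i , i≤L , refl , proj₁ (∈-N⁻ G H y∈NH)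

  card-gaps≡1 : ∀ {i} → vℓ ∈ᵥ H → i ≤ L → p i ∉ᵥ H → card gaps ≡ 1
  card-gaps≡1 {i} vℓ∈H i≤L pi∉H = ≤-antisym (⊆｛｝⇒card≤1 gaps gaps⊆pi) (∈⇒1≤card gaps pi∈gaps)
    where
    gaps⊆pi : gaps ⊆ᵥ ｛ p i ｝
    gaps⊆pi y y∈gaps with gaps⊆path∖H y∈gaps
    ... | j , j≤L , refl , pj∉H rewrite outside-unique j≤L i≤L pj∉H pi∉H = ∈-｛｝ (p i)

    pi∉F : p i ∉ᵥ F
    pi∉F = ¬-not λ pi∈F → ∈∧∉⇒⊥ H (F⊆H (p i) pi∈F) pi∉H

    pi∈gaps : p i ∈ᵥ gaps
    pi∈gaps with p i ≟ vℓ
    ... | yes pi≡vℓ = ⊥-elim (∈∧∉⇒⊥ H vℓ∈H (subst (_∉ᵥ H) pi≡vℓ pi∉H))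
    ... | no  _ rewrite outside⇒∈N i≤L pi∉H | p∈P i≤L | pi∉F = refl

  card-gaps≡0 : listSet P ⊆ᵥ H → card gaps ≡ 0
  card-gaps≡0 P⊆H = ∅⇒card≡0 gaps λ y → ¬-not λ y∈gaps → gap-in-H (gaps⊆path∖H y∈gaps)
    where
    gap-in-H : ∀ {y} → (∃ λ i → i ≤ L × p i ≡ y × p i ∉ᵥ H) → ⊥
    gap-in-H (i , i≤L , _ , pi∉H) = ∈∧∉⇒⊥ H (P⊆H (p i) (p∈P i≤L)) pi∉H

  vℓ∈P : vℓ ∈ᵥ listSet P
  vℓ∈P = subst (_∈ᵥ listSet P) p-last (p∈P ≤-refl)

  vℓ∉N⇒vℓ∈H : ¬ vℓ ∈ᵥ N G H → vℓ ∈ᵥ H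
  vℓ∉N⇒vℓ∈H vℓ∉NH = ¬-not λ vℓ∉H →
    vℓ∉NH (subst (_∈ᵥ N G H) p-last (outside⇒∈N ≤-refl (subst (_∉ᵥ H) (sym p-last) vℓ∉H)))

  trichotomy : ExactlyOne (vℓ ∈ᵥ N G H) (card gaps ≡ 1 × vℓ ∈ᵥ H) (listSet P ⊆ᵥ H)
  trichotomy with N G H vℓ in vℓ∈NH?
  ... | true = inj₁ (refl , (λ (_ , vℓ∈H) → vℓ∉H vℓ∈H) , (λ P⊆H → vℓ∉H (P⊆H vℓ vℓ∈P)))
    where
    vℓ∉H : ¬ vℓ ∈ᵥ H
    vℓ∉H vℓ∈H = ∈∧∉⇒⊥ H vℓ∈H (proj₁ (∈-N⁻ G H vℓ∈NH?))
  ... | false with anyUpTo? (λ i → H (p i) Data.Bool.≟ false) (suc L)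
  ...   | yes (i , s≤s i≤L , pi∉H) = inj₂ (inj₁ ((λ ()) , (card-gaps≡1 vℓ∈H i≤L pi∉H , vℓ∈H) , P⊈H))
    where
    vℓ∈H : vℓ ∈ᵥ H
    vℓ∈H = vℓ∉N⇒vℓ∈H λ vℓ∈NH → ∈∧∉⇒⊥ (N G H) vℓ∈NH vℓ∈NH?
    P⊈H : ¬ listSet P ⊆ᵥ H
    P⊈H P⊆H = ∈∧∉⇒⊥ H (P⊆H (p i) (p∈P i≤L)) pi∉H
  ...   | no none = inj₂ (inj₂ ((λ ()) , (λ (card≡1 , _) → 0≢1+n (trans (sym card≡0) card≡1)) , P⊆H))
    where
    P⊆H : listSet P ⊆ᵥ H
    P⊆H y y∈P with ∈⇒index (∈listSet⇒∈ P y∈P)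
    ... | i , i≤L , refl = ¬-not λ pi∉H → none (i , s≤s i≤L , pi∉H)
    card≡0 : card gaps ≡ 0
    card≡0 = card-gaps≡0 P⊆H

lemma5 : ∀ {n} (G : Graph n) (k : ℕ) (F T : VSet n) (w : Fin n → ℕ)
    → IsELSS G k F T w
    → AlmostLeafless G F
    → Connected G (λ _ → Data.Bool.true)
    → (∃ λ y → y ∈ᵥ N G F)
    → (v : Fin n) → v ∈ᵥ N G T
    → (vℓ : Fin n) (P : List (Fin n)) → PathProcess G T v vℓ P
    → (H : VSet n) → MaxSecludedSupertree G k F w H
    → ExactlyOne
        (vℓ ∈ᵥ N G H)
        (card (λ y → N G H y ∧ listSet P y ∧ not (F y) ∧ not ⌊ y ≟ vℓ ⌋) ≡ 1 × vℓ ∈ᵥ H)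
        (listSet P ⊆ᵥ H)
lemma5 G k F T w elss _ _ _ v v∈NT vℓ P (reach , _) H H-max = Trichotomy.trichotomy elss v∈NT reach H-max
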